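{- Let $\mathbf{L}=(L,\wedge,\vee)$ be a semidistributive lattice. Then $\mathbf{L}$ hypersatisfies the hyper-quasi-identity $$(F(x,y)=F(x,z))\rightarrow (F(x,y)=F(x,G(y,z))),$$ where $F,G$ are binary hypervariables; that is, for all binary term operations $f,g$ of $\mathbf{L}$ and all $x,y,z\in L$, if $f(x,y)=f(x,z)$ then $f(x,y)=f(x,g(y,z))$.
   Context: A lattice is join-semidistributive if $x\vee y=x\vee z$ implies $x\vee y=x\vee(y\wedge z)$, and meet-semidistributive if $x\wedge y=x\wedge z$ implies $x\wedge y=x\wedge(y\vee z)$; it is semidistributive if it is both. Hypervariables are symbols standing for operations of a fixed arity; a hyper-quasi-identity is hypersatisfied in an algebra if for every substitution of the hypervariables by term operations of the algebra of the same arity (variables left unchanged) the resulting quasi-identity holds in the algebra for all values of the variables. -}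

module Defs where

open import Level using (Level)
open import Data.Nat using (ℕ)
open import Data.Product using (_×_)
open import Data.Fin using (Fin; zero; suc)
open import Algebra.Lattice.Bundles using (Lattice)

data Term (n : ℕ) : Set where
  var  : Fin n → Term n
  _∧ₜ_ : Term n → Term n → Term n
  _∨ₜ_ : Term n → Term n → Term n

module _ {c ℓ : Level} (L : Lattice c ℓ) where
  open Lattice L

  ⟦_⟧ : {n : ℕ} → Term n → (Fin n → Carrier) → Carrier
  ⟦ var i ⟧ ρ = ρ i
  ⟦ s ∧ₜ t ⟧ ρ = ⟦ s ⟧ ρ ∧ ⟦ t ⟧ ρ
  ⟦ s ∨ₜ t ⟧ ρ = ⟦ s ⟧ ρ ∨ ⟦ t ⟧ ρ

  binOp : Term 2 → Carrier → Carrier → Carrier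
  binOp t a b = ⟦ t ⟧ (λ { zero → a ; (suc zero) → b })

  JoinSemidistributive : Set (c Level.⊔ ℓ)
  JoinSemidistributive = ∀ x y z → (x ∨ y) ≈ (x ∨ z) → (x ∨ y) ≈ (x ∨ (y ∧ z))

  MeetSemidistributive : Set (c Level.⊔ ℓ)
  MeetSemidistributive = ∀ x y z → (x ∧ y) ≈ (x ∧ z) → (x ∧ y) ≈ (x ∧ (y ∨ z))

  Semidistributive : Set (c Level.⊔ ℓ)
  Semidistributive = JoinSemidistributive × MeetSemidistributive

module Submission where

open import Defs
open import Level using (Level)
open import Algebra.Lattice.Bundles using (Lattice)
open import Algebra.Lattice.Properties.Lattice using (∧-∨-lattice)
import Algebra.Lattice.Properties.Lattice as LatticeProperties
open import Data.Fin using (zero; suc)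
open import Data.Product using (_,_)
open import Relation.Binary.Bundles using (Poset)
open import Relation.Binary.Lattice.Structures using (IsLattice)
open import Relation.Binary.PropositionalEquality using (_≡_)
import Relation.Binary.PropositionalEquality as ≡
import Relation.Binary.Reasoning.Setoid as SetoidReasoning

-- Every binary lattice term t(x, w) equals one of x, w, x ∧ w, x ∨ w (the
-- free lattice on two generators is the four-element Boolean lattice).  For
-- each of these four shapes the fibre { w | t(x, w) = t(x, y) } is closed
-- under ∧ and ∨: for x ∨ w this is join-semidistributivity, for x ∧ w
-- meet-semidistributivity, and the remaining cases hold in every lattice.
-- A sublattice is closed under all term operations, so it contains g(y, z)
-- as soon as it contains y and z.

data BinaryNF : Set where
  v₀ v₁ v₀∧v₁ v₀∨v₁ : BinaryNF

infixr 7 _⊓_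
infixr 6 _⊔_

_⊓_ : BinaryNF → BinaryNF → BinaryNF
v₀∨v₁ ⊓ b     = b
v₀∧v₁ ⊓ b     = v₀∧v₁
a     ⊓ v₀∨v₁ = a
a     ⊓ v₀∧v₁ = v₀∧v₁
v₀    ⊓ v₀    = v₀
v₀    ⊓ v₁    = v₀∧v₁
v₁    ⊓ v₀    = v₀∧v₁
v₁    ⊓ v₁    = v₁

dual : BinaryNF → BinaryNF
dual v₀∧v₁ = v₀∨v₁
dual v₀∨v₁ = v₀∧v₁
dual a     = a

_⊔_ : BinaryNF → BinaryNF → BinaryNF
a ⊔ b = dual (dual a ⊓ dual b)

normalise : Term 2 → BinaryNF
normalise (var zero)       = v₀
normalise (var (suc zero)) = v₁
normalise (s ∧ₜ t)         = normalise s ⊓ normalise t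
normalise (s ∨ₜ t)         = normalise s ⊔ normalise t

module _ {c ℓ : Level} (L : Lattice c ℓ) where
  open Lattice L

  evalNF : BinaryNF → Carrier → Carrier → Carrier
  evalNF v₀    x w = x
  evalNF v₁    x w = w
  evalNF v₀∧v₁ x w = x ∧ w
  evalNF v₀∨v₁ x w = x ∨ w

  binOp-preserves : ∀ {p} (P : Carrier → Set p) →
                    (∀ {u v} → P u → P v → P (u ∧ v)) →
                    (∀ {u v} → P u → P v → P (u ∨ v)) →
                    ∀ G {u v} → P u → P v → P (binOp L G u v)
  binOp-preserves P ∧-closed ∨-closed = go
    where
    go : ∀ G {u v} → P u → P v → P (binOp L G u v)
    go (var zero)       pu pv = pu
    go (var (suc zero)) pu pv = pv
    go (s ∧ₜ t)         pu pv = ∧-closed (go s pu pv) (go t pu pv)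
    go (s ∨ₜ t)         pu pv = ∨-closed (go s pu pv) (go t pu pv)

evalNF-dual : ∀ {c ℓ} (L : Lattice c ℓ) a x w →
              evalNF (∧-∨-lattice L) (dual a) x w ≡ evalNF L a x w
evalNF-dual L v₀    x w = ≡.refl
evalNF-dual L v₁    x w = ≡.refl
evalNF-dual L v₀∧v₁ x w = ≡.refl
evalNF-dual L v₀∨v₁ x w = ≡.refl

module _ {c ℓ : Level} (L : Lattice c ℓ) where
  open Lattice L
  open LatticeProperties L using (∧-idem; poset; ∨-∧-isOrderTheoreticLattice)
  open Poset poset using (_≤_)
  open IsLattice ∨-∧-isOrderTheoreticLattice using (x∧y≤x; x∧y≤y; x≤x∨y; y≤x∨y)
    renaming (refl to ≤-refl; trans to ≤-trans)
  open SetoidReasoning setoid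

  ∧≤evalNF : ∀ a x w → x ∧ w ≤ evalNF L a x w
  ∧≤evalNF v₀    x w = x∧y≤x x w
  ∧≤evalNF v₁    x w = x∧y≤y x w
  ∧≤evalNF v₀∧v₁ x w = ≤-refl
  ∧≤evalNF v₀∨v₁ x w = ≤-trans (x∧y≤x x w) (x≤x∨y x w)

  evalNF≤∨ : ∀ a x w → evalNF L a x w ≤ x ∨ w
  evalNF≤∨ v₀    x w = x≤x∨y x w
  evalNF≤∨ v₁    x w = y≤x∨y x w
  evalNF≤∨ v₀∧v₁ x w = ≤-trans (x∧y≤x x w) (x≤x∨y x w)
  evalNF≤∨ v₀∨v₁ x w = ≤-refl

  -- In the left natural order u ≤ v unfolds to u ≈ u ∧ v.
  evalNF-⊓ : ∀ a b x w → evalNF L (a ⊓ b) x w ≈ evalNF L a x w ∧ evalNF L b x w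
  evalNF-⊓ v₀∨v₁ b     x w = trans (evalNF≤∨ b x w) (∧-comm _ _)
  evalNF-⊓ v₀∧v₁ b     x w = ∧≤evalNF b x w
  evalNF-⊓ v₀    v₀∨v₁ x w = evalNF≤∨ v₀ x w
  evalNF-⊓ v₁    v₀∨v₁ x w = evalNF≤∨ v₁ x w
  evalNF-⊓ v₀    v₀∧v₁ x w = trans (∧≤evalNF v₀ x w) (∧-comm _ _)
  evalNF-⊓ v₁    v₀∧v₁ x w = trans (∧≤evalNF v₁ x w) (∧-comm _ _)
  evalNF-⊓ v₀    v₀    x w = sym (∧-idem x)
  evalNF-⊓ v₀    v₁    x w = refl
  evalNF-⊓ v₁    v₀    x w = ∧-comm x w
  evalNF-⊓ v₁    v₁    x w = sym (∧-idem w)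

  x∧u≈x∧v⇒x∧u≈x∧[u∧v] : ∀ x u v → x ∧ u ≈ x ∧ v → x ∧ u ≈ x ∧ (u ∧ v)
  x∧u≈x∧v⇒x∧u≈x∧[u∧v] x u v eq = begin
    x ∧ u        ≈⟨ eq ⟩
    x ∧ v        ≈⟨ ∧-congˡ (∧-idem v) ⟨
    x ∧ (v ∧ v)  ≈⟨ ∧-assoc x v v ⟨
    (x ∧ v) ∧ v  ≈⟨ ∧-congʳ eq ⟨
    (x ∧ u) ∧ v  ≈⟨ ∧-assoc x u v ⟩
    x ∧ (u ∧ v)  ∎

  evalNF-∧-closed : JoinSemidistributive L → ∀ a x {u v} →
                    evalNF L a x u ≈ evalNF L a x v →
                    evalNF L a x u ≈ evalNF L a x (u ∧ v)
  evalNF-∧-closed jsd v₀    x     eq = refl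
  evalNF-∧-closed jsd v₁    x {u} eq = trans (sym (∧-idem u)) (∧-congˡ eq)
  evalNF-∧-closed jsd v₀∧v₁ x     eq = x∧u≈x∧v⇒x∧u≈x∧[u∧v] x _ _ eq
  evalNF-∧-closed jsd v₀∨v₁ x     eq = jsd x _ _ eq

module _ {c ℓ : Level} (L : Lattice c ℓ) where
  open Lattice L
  open SetoidReasoning setoid

  private
    L° : Lattice c ℓ
    L° = ∧-∨-lattice L

  evalNF-⊔ : ∀ a b x w → evalNF L (a ⊔ b) x w ≈ evalNF L a x w ∨ evalNF L b x w
  evalNF-⊔ a b x w = begin
    evalNF L (dual (dual a ⊓ dual b)) x w             ≡⟨ evalNF-dual L° (dual a ⊓ dual b) x w ⟩
    evalNF L° (dual a ⊓ dual b) x w                   ≈⟨ evalNF-⊓ L° (dual a) (dual b) x w ⟩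
    evalNF L° (dual a) x w ∨ evalNF L° (dual b) x w   ≡⟨ ≡.cong₂ _∨_ (evalNF-dual L a x w) (evalNF-dual L b x w) ⟩
    evalNF L a x w ∨ evalNF L b x w                   ∎

  -- Meet-semidistributivity of L is join-semidistributivity of L°.
  evalNF-∨-closed : MeetSemidistributive L → ∀ a x {u v} →
                    evalNF L a x u ≈ evalNF L a x v →
                    evalNF L a x u ≈ evalNF L a x (u ∨ v)
  evalNF-∨-closed msd v₀    = evalNF-∧-closed L° msd v₀
  evalNF-∨-closed msd v₁    = evalNF-∧-closed L° msd v₁
  evalNF-∨-closed msd v₀∧v₁ = evalNF-∧-closed L° msd v₀∨v₁
  evalNF-∨-closed msd v₀∨v₁ = evalNF-∧-closed L° msd v₀∧v₁

  normalise-sound : ∀ t x w → binOp L t x w ≈ evalNF L (normalise t) x w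
  normalise-sound (var zero)       x w = refl
  normalise-sound (var (suc zero)) x w = refl
  normalise-sound (s ∧ₜ t) x w =
    trans (∧-cong (normalise-sound s x w) (normalise-sound t x w))
          (sym (evalNF-⊓ L (normalise s) (normalise t) x w))
  normalise-sound (s ∨ₜ t) x w =
    trans (∨-cong (normalise-sound s x w) (normalise-sound t x w))
          (sym (evalNF-⊔ (normalise s) (normalise t) x w))

  evalNF-fibre-binOp-closed : Semidistributive L → ∀ a x G {c u v} →
                              c ≈ evalNF L a x u → c ≈ evalNF L a x v →
                              c ≈ evalNF L a x (binOp L G u v)
  evalNF-fibre-binOp-closed (jsd , msd) a x G {c} =
    binOp-preserves L (λ w → c ≈ evalNF L a x w)
      (λ cu cv → trans cu (evalNF-∧-closed L jsd a x (trans (sym cu) cv)))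
      (λ cu cv → trans cu (evalNF-∨-closed msd a x (trans (sym cu) cv)))
      G

proposition3p2 : {c ℓ : Level} (L : Lattice c ℓ) → Semidistributive L →
    (F G : Term 2) → (x y z : Lattice.Carrier L) →
    Lattice._≈_ L (binOp L F x y) (binOp L F x z) →
    Lattice._≈_ L (binOp L F x y) (binOp L F x (binOp L G y z))
proposition3p2 L sd F G x y z fxy≈fxz = begin
  binOp L F x y                   ≈⟨ normalise-sound L F x y ⟩
  evalNF L f x y                  ≈⟨ evalNF-fibre-binOp-closed L sd f x G refl fxy≈fxz′ ⟩
  evalNF L f x (binOp L G y z)    ≈⟨ normalise-sound L F x (binOp L G y z) ⟨
  binOp L F x (binOp L G y z)     ∎
  where
  open Lattice L
  open SetoidReasoning setoid
  f : BinaryNF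
  f = normalise F
  fxy≈fxz′ : evalNF L f x y ≈ evalNF L f x z
  fxy≈fxz′ = trans (sym (normalise-sound L F x y)) (trans fxy≈fxz (normalise-sound L F x z))
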